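{- For all tuples $L=(l_1,\dots,l_r)$ and $L'=(l'_1,\dots,l'_r)$ of distinct indices in $[1,n]$ of the same length $r$ and all $i \in [1,r]$, \[ \sum_{a \in ([1,n]\setminus I_{L'})\cup\{l'_i\}} c\big(L,(l'_1,\dots,l'_{i-1},a,l'_{i+1},\dots,l'_r)\big) = 0. \]
   Context: $I_L = \{l_1,\dots,l_r\}$. For tuples $L,L'$ of distinct indices of the same length $r$: $c(L,L') = 0$ if there exist $i \ne j$ with $l'_j = l_i$; otherwise, with $z = |\{i : l'_i \ne l_i\}|$, $c(L,L') = \frac{(-1)^z}{\prod_{j=0}^{z-1}(n-r-j)}$ (empty product equal to $1$).
   Formalization: The identity is claimed only for 2r ≤ n, that is, for tuples L and L′ of length r at most n/2. The statement above fails without it. -}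

module Defs where

open import Data.Nat as ℕ using (ℕ; zero; suc; _∸_)
open import Data.Integer as ℤ using (ℤ)
open import Data.Rational as ℚ using (ℚ; 0ℚ)
open import Data.Fin using (Fin)
open import Data.Fin.Properties using (_≟_; any?)
open import Data.List using (List; foldr; map)
open import Data.List.Base using (allFin)
open import Data.Bool using (Bool; true; false; if_then_else_; _∨_)
open import Data.Product using (_×_)
open import Relation.Nullary using (¬?; ⌊_⌋)
open import Relation.Nullary.Decidable using (_×-dec_)

-- Tuples of length r of indices in [1,n] are functions Fin r → Fin n
-- (indices shifted to 0-based). Distinctness is a separate hypothesis.

sumℚ : {A : Set} → List A → (A → ℚ) → ℚ
sumℚ xs f = foldr ℚ._+_ 0ℚ (map f xs)

fallProd : ℕ → ℕ → ℕ
fallProd m zero = 1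
fallProd m (suc z) = fallProd m z ℕ.* (m ∸ z)

-- p / d in ℚ; the case d = 0 never arises in c, it is set to 0
divℚ : ℤ → ℕ → ℚ
divℚ p zero = 0ℚ
divℚ p (suc d) = p ℚ./ suc d

crossHit : {n r : ℕ} → (Fin r → Fin n) → (Fin r → Fin n) → Bool
crossHit {r = r} L L' = ⌊ any? (λ i → any? (λ j → ¬? (i ≟ j) ×-dec (L' j ≟ L i))) ⌋

numDiff : {n r : ℕ} → (Fin r → Fin n) → (Fin r → Fin n) → ℕ
numDiff {r = r} L L' = foldr ℕ._+_ 0 (map (λ i → if ⌊ L' i ≟ L i ⌋ then 0 else 1) (allFin r))

c : {n r : ℕ} → (Fin r → Fin n) → (Fin r → Fin n) → ℚ
c {n} {r} L L' =
  if crossHit L L' then 0ℚ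
  else divℚ (ℤ.-1ℤ ℤ.^ numDiff L L') (fallProd (n ∸ r) (numDiff L L'))

replaceAt : {n r : ℕ} → (Fin r → Fin n) → Fin r → Fin n → (Fin r → Fin n)
replaceAt L' i a k = if ⌊ k ≟ i ⌋ then a else L' k

inRange : {n r : ℕ} → (Fin r → Fin n) → Fin r → Fin n → Bool
inRange L' i a = (if ⌊ any? (λ k → L' k ≟ a) ⌋ then false else true) ∨ ⌊ a ≟ L' i ⌋

module Submission where

-- Write L′[a] for L′ with its i-th entry replaced by a, so that the summands are
-- c(L, L′[a]).  If l′_j = l_k for some j ≠ i and k ≠ j, this cross hit occurs in
-- every L′[a] and all summands vanish.  Otherwise let z be the number of k ≠ i
-- with l′_k ≠ l_k and U = I_L ∪ (I_L′ ∖ {l′_i}), a set of r + z elements.  With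
-- m = n - r and (m)_z the falling product, the summand is (-1)^z/(m)_z for a = l_i,
-- zero for the other a ∈ U, and (-1)^(z+1)/(m)_(z+1) for each of the m - z
-- elements a ∉ U.  As (m)_(z+1) = (m)_z (m - z), these cancel; 2r ≤ n gives
-- z < r ≤ m, so none of the falling products is zero.

open import Defs
open import Algebra.Bundles using (Monoid)
import Algebra.Properties.CommutativeMonoid.Sum as CommutativeMonoidSum
import Algebra.Properties.Monoid.Mult as MonoidMult
import Algebra.Properties.Monoid.Sum as MonoidSum
open import Data.Bool using (true; false; if_then_else_; _∨_)
open import Data.Fin using (Fin; zero; suc; punchIn)
open import Data.Fin.Properties using (_≟_; any?; punchInᵢ≢i)
open import Data.Integer as ℤ using (ℤ; 0ℤ; 1ℤ; -1ℤ)
open import Data.Integer.Tactic.RingSolver using (solve-∀)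
open import Data.List using (List; []; _∷_; _++_; foldr; map; filter; length; tabulate; allFin)
import Data.List.Properties as List
open import Data.List.Membership.Propositional using (_∈_; _∉_; lose)
open import Data.List.Membership.Propositional.Properties
  using (∈-allFin; ∈-map⁺; ∈-map⁻; ∈-++⁺ˡ; ∈-++⁺ʳ; ∈-++⁻; ∈-filter⁺; ∈-filter⁻)
open import Data.List.Relation.Unary.Unique.Propositional using (Unique; _∷_)
import Data.List.Relation.Unary.Unique.Propositional.Properties as Unique
open import Data.Nat as ℕ using (ℕ; zero; suc; _+_; _∸_; _*_; _≤_; _<_; NonZero)
import Data.Nat.Properties as ℕ
open import Data.Product using (_×_; _,_; proj₂; ∃; ∃₂)
open import Data.Rational as ℚ using (ℚ; 0ℚ; toℚᵘ)
import Data.Rational.Properties as ℚ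
open import Data.Rational.Unnormalised as ℚᵘ using (ℚᵘ; mkℚᵘ; *≡*) renaming (_≃_ to _≃ᵘ_)
import Data.Rational.Unnormalised.Properties as ℚᵘ
open import Data.Sum using (_⊎_; inj₁; inj₂)
import Data.Vec.Functional as Vector
open import Function using (_∘_)
open import Function.Definitions using (Injective)
open import Relation.Binary.PropositionalEquality
open import Relation.Nullary using (Dec; yes; no; does; ¬_; ¬?; _×-dec_; ⌊_⌋; contradiction)
open import Relation.Nullary.Decidable using (isYes≗does; dec-true; dec-false)

open import Algebra.Properties.CommutativeMonoid.Sum ℕ.+-0-commutativeMonoid
  using (sum; sum-syntax; sum-cong-≗; sum-remove; sum-replicate-zero; ∑-distrib-+)
module ℚΣ = CommutativeMonoidSum ℚ.+-0-commutativeMonoid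
open MonoidMult ℚ.+-0-monoid using () renaming (_×_ to _×ℚ_)

import Data.List.Membership.DecPropositional
open module FinMembership {n} = Data.List.Membership.DecPropositional (_≟_ {n}) using (_∈?_; _∉?_)

private
  variable
    A B : Set
    n r : ℕ

⌊⌋-yes : (d : Dec A) → A → ⌊ d ⌋ ≡ true
⌊⌋-yes d a = trans (isYes≗does d) (dec-true d a)

⌊⌋-no : (d : Dec A) → ¬ A → ⌊ d ⌋ ≡ false
⌊⌋-no d ¬a = trans (isYes≗does d) (dec-false d ¬a)

foldr-map-tabulate : (_∙_ : B → B → B) (ε : B) (f : A → B) (g : Fin n → A) →
                     foldr _∙_ ε (map f (tabulate g)) ≡ Vector.foldr _∙_ ε (f ∘ g)
foldr-map-tabulate {n = zero}  _∙_ ε f g = refl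
foldr-map-tabulate {n = suc n} _∙_ ε f g =
  cong (f (g zero) ∙_) (foldr-map-tabulate _∙_ ε f (g ∘ suc))

𝟙 : Dec A → ℕ
𝟙 d = if does d then 1 else 0

∑-𝟙≟ : (b : Fin n) → ∑[ a < n ] 𝟙 (a ≟ b) ≡ 1
∑-𝟙≟ {suc n} zero    = cong suc (sum-replicate-zero n)
∑-𝟙≟ {suc n} (suc b) = ∑-𝟙≟ b

∑-1 : ∀ n → ∑[ a < n ] 1 ≡ n
∑-1 zero    = refl
∑-1 (suc n) = cong suc (∑-1 n)

𝟙∉∷+𝟙≟ : ∀ {x : Fin n} {U} → x ∉ U → ∀ a → 𝟙 (a ∉? (x ∷ U)) + 𝟙 (a ≟ x) ≡ 𝟙 (a ∉? U)
𝟙∉∷+𝟙≟ {x = x} {U} x∉U a with a ≟ x | a ∈? U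
... | yes refl | yes a∈U = contradiction a∈U x∉U
... | yes _    | no _    = refl
... | no _     | yes _   = refl
... | no _     | no _    = refl

∑-𝟙∉ : (U : List (Fin n)) → Unique U → ∑[ a < n ] 𝟙 (a ∉? U) + length U ≡ n
∑-𝟙∉ {n} []      _                           = trans (ℕ.+-identityʳ _) (∑-1 n)
∑-𝟙∉ {n} (x ∷ U) x∷U-unique@(_ ∷ U-unique) = begin
  S + suc (length U)                              ≡⟨ ℕ.+-assoc S 1 (length U) ⟨
  S + 1 + length U                                ≡⟨ cong (λ s → S + s + length U) (∑-𝟙≟ x) ⟨
  S + ∑[ a < n ] 𝟙 (a ≟ x) + length U             ≡⟨ cong (_+ length U) (∑-distrib-+ f (λ a → 𝟙 (a ≟ x))) ⟨
  ∑[ a < n ] (f a + 𝟙 (a ≟ x)) + length U         ≡⟨ cong (_+ length U) (sum-cong-≗ (𝟙∉∷+𝟙≟ x∉U)) ⟩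
  ∑[ a < n ] 𝟙 (a ∉? U) + length U                ≡⟨ ∑-𝟙∉ U U-unique ⟩
  n                                               ∎
  where
  open ≡-Reasoning
  f : Fin n → ℕ
  f a = 𝟙 (a ∉? (x ∷ U))
  S = sum f
  x∉U = Unique.Unique[x∷xs]⇒x∉xs x∷U-unique

module _ {c ℓ} (M : Monoid c ℓ) where
  open Monoid M using (Carrier; _≈_; ∙-congˡ)
    renaming (refl to ≈-refl; sym to ≈-sym; trans to ≈-trans)
  open MonoidSum M using () renaming (sum to ∑ᴹ)
  open MonoidMult M using () renaming (_×_ to _×ᴹ_; ×-homo-+ to ×ᴹ-homo-+)

  ∑-× : (g : Fin n → ℕ) (x : Carrier) → ∑ᴹ (λ a → g a ×ᴹ x) ≈ sum g ×ᴹ x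
  ∑-× {zero}  g x = ≈-refl
  ∑-× {suc n} g x =
    ≈-trans (∙-congˡ (∑-× (g ∘ suc) x)) (≈-sym (×ᴹ-homo-+ x (g zero) (sum (g ∘ suc))))

_/1 : ℕ → ℚᵘ
k /1 = mkℚᵘ (ℤ.+ k) 0

1+k/1≃suc[k]/1 : ∀ k → ℚᵘ.1ℚᵘ ℚᵘ.+ k /1 ≃ᵘ suc k /1
1+k/1≃suc[k]/1 k = *≡* (identity (ℤ.+ k))
  where
  identity : ∀ K → (1ℤ ℤ.* 1ℤ ℤ.+ K ℤ.* 1ℤ) ℤ.* 1ℤ ≡ (1ℤ ℤ.+ K) ℤ.* 1ℤ
  identity = solve-∀

toℚᵘ-× : ∀ k q → toℚᵘ (k ×ℚ q) ≃ᵘ k /1 ℚᵘ.* toℚᵘ q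
toℚᵘ-× zero    q = ℚᵘ.≃-sym (ℚᵘ.*-zeroˡ (toℚᵘ q))
toℚᵘ-× (suc k) q = begin
  toℚᵘ (q ℚ.+ k ×ℚ q)                      ≈⟨ ℚ.toℚᵘ-homo-+ q (k ×ℚ q) ⟩
  toℚᵘ q ℚᵘ.+ toℚᵘ (k ×ℚ q)                ≈⟨ ℚᵘ.+-cong (ℚᵘ.≃-sym (ℚᵘ.*-identityˡ q′)) (toℚᵘ-× k q) ⟩
  ℚᵘ.1ℚᵘ ℚᵘ.* q′ ℚᵘ.+ k /1 ℚᵘ.* q′        ≈⟨ ℚᵘ.*-distribʳ-+ q′ ℚᵘ.1ℚᵘ (k /1) ⟨
  (ℚᵘ.1ℚᵘ ℚᵘ.+ k /1) ℚᵘ.* q′              ≈⟨ ℚᵘ.*-congʳ {q′} (1+k/1≃suc[k]/1 k) ⟩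
  suc k /1 ℚᵘ.* q′                         ∎
  where
  open ℚᵘ.≃-Reasoning
  q′ = toℚᵘ q

s/F+k×[-s/Fk]≡0 : ∀ (s : ℤ) F k .{{_ : NonZero F}} .{{_ : NonZero k}} →
                  divℚ s F ℚ.+ k ×ℚ divℚ (-1ℤ ℤ.* s) (F * k) ≡ 0ℚ
s/F+k×[-s/Fk]≡0 s (suc p) (suc q) = ℚ.toℚᵘ-injective (begin
  toℚᵘ (x ℚ.+ suc q ×ℚ y)                  ≈⟨ ℚ.toℚᵘ-homo-+ x (suc q ×ℚ y) ⟩
  toℚᵘ x ℚᵘ.+ toℚᵘ (suc q ×ℚ y)            ≈⟨ ℚᵘ.+-cong (ℚ.toℚᵘ-fromℚᵘ (mkℚᵘ s p)) (toℚᵘ-× (suc q) y) ⟩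
  mkℚᵘ s p ℚᵘ.+ suc q /1 ℚᵘ.* toℚᵘ y       ≈⟨ ℚᵘ.+-congʳ (mkℚᵘ s p) (ℚᵘ.*-congˡ {suc q /1} (ℚ.toℚᵘ-fromℚᵘ (mkℚᵘ t d))) ⟩
  mkℚᵘ s p ℚᵘ.+ suc q /1 ℚᵘ.* mkℚᵘ t d     ≈⟨ *≡* numerator-vanishes ⟩
  ℚᵘ.0ℚᵘ                                   ∎)
  where
  open ℚᵘ.≃-Reasoning
  t = -1ℤ ℤ.* s
  d = q + p * suc q
  x = divℚ s (suc p)
  y = divℚ t (suc p * suc q)
  cancel : ∀ S P K → (S ℤ.* (P ℤ.* K) ℤ.+ (K ℤ.* (-1ℤ ℤ.* S)) ℤ.* P) ℤ.* 1ℤ ≡ 0ℤ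
  cancel = solve-∀
  -- ℚᵘ multiplication leaves the denominator 1 * suc d, which computes to suc (d + 0).
  numerator-vanishes : (s ℤ.* ℤ.+ suc (d + 0) ℤ.+ (ℤ.+ suc q ℤ.* t) ℤ.* ℤ.+ suc p) ℤ.* 1ℤ ≡ 0ℤ
  numerator-vanishes =
    trans (cong (λ e → (s ℤ.* ℤ.+ suc e ℤ.+ (ℤ.+ suc q ℤ.* t) ℤ.* ℤ.+ suc p) ℤ.* 1ℤ) (ℕ.+-identityʳ d))
          (cancel s (ℤ.+ suc p) (ℤ.+ suc q))

signedInverseFalling : ℕ → ℕ → ℚ
signedInverseFalling m z = divℚ (-1ℤ ℤ.^ z) (fallProd m z)

fallProd-nonZero : ∀ {m z} → z ≤ m → NonZero (fallProd m z)
fallProd-nonZero {z = zero}  _   = _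
fallProd-nonZero {m} {suc z} z<m = ℕ.m*n≢0 (fallProd m z) (m ∸ z)
  {{fallProd-nonZero (ℕ.<⇒≤ z<m)}} {{ℕ.>-nonZero (ℕ.m<n⇒0<n∸m z<m)}}

signedInverseFalling-recurrence : ∀ {m z} → z < m →
  signedInverseFalling m z ℚ.+ (m ∸ z) ×ℚ signedInverseFalling m (suc z) ≡ 0ℚ
signedInverseFalling-recurrence {m} {z} z<m = s/F+k×[-s/Fk]≡0 (-1ℤ ℤ.^ z) (fallProd m z) (m ∸ z)
  {{fallProd-nonZero (ℕ.<⇒≤ z<m)}} {{ℕ.>-nonZero (ℕ.m<n⇒0<n∸m z<m)}}

CrossHit : (L M : Fin r → Fin n) → Set
CrossHit L M = ∃₂ λ k j → k ≢ j × M j ≡ L k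

crossHit? : (L M : Fin r → Fin n) → Dec (CrossHit L M)
crossHit? L M = any? λ k → any? λ j → ¬? (k ≟ j) ×-dec (M j ≟ L k)

c-crossHit : (L M : Fin r → Fin n) → CrossHit L M → c L M ≡ 0ℚ
c-crossHit {r} {n} L M hit =
  cong (λ b → if b then 0ℚ else signedInverseFalling (n ∸ r) (numDiff L M))
       (⌊⌋-yes (crossHit? L M) hit)

c-noCrossHit : (L M : Fin r → Fin n) → ¬ CrossHit L M →
               c L M ≡ signedInverseFalling (n ∸ r) (numDiff L M)
c-noCrossHit {r} {n} L M ¬hit =
  cong (λ b → if b then 0ℚ else signedInverseFalling (n ∸ r) (numDiff L M))
       (⌊⌋-no (crossHit? L M) ¬hit)

mismatch : (L M : Fin r → Fin n) → Fin r → ℕ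
mismatch L M k = if ⌊ M k ≟ L k ⌋ then 0 else 1

numDiff≡∑ : (L M : Fin r → Fin n) → numDiff L M ≡ sum (mismatch L M)
numDiff≡∑ L M = foldr-map-tabulate _+_ 0 (mismatch L M) (λ k → k)

length-filter-¬ : ∀ {P : A → Set} (P? : ∀ x → Dec (P x)) xs →
                  length (filter (¬? ∘ P?) xs)
                    ≡ foldr _+_ 0 (map (λ x → if ⌊ P? x ⌋ then 0 else 1) xs)
length-filter-¬ P? []       = refl
length-filter-¬ P? (x ∷ xs) with P? x
... | yes _ = length-filter-¬ P? xs
... | no  _ = cong suc (length-filter-¬ P? xs)

numDiff≡length : (L M : Fin r → Fin n) →
                 numDiff L M ≡ length (filter (λ k → ¬? (M k ≟ L k)) (allFin r))
numDiff≡length L M = sym (length-filter-¬ (λ k → M k ≟ L k) (allFin _))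

numDiff-< : (L M : Fin r → Fin n) (i : Fin r) → M i ≡ L i → numDiff L M < r
numDiff-< {r} L M i agree = subst₂ _<_ (sym (numDiff≡length L M)) (List.length-tabulate (λ k → k))
  (List.filter-notAll (λ k → ¬? (M k ≟ L k)) (allFin r)
                      (lose (∈-allFin i) (λ disagree → disagree agree)))

numDiff-bump : (L M M′ : Fin r → Fin n) (i : Fin r) → (∀ k → k ≢ i → M k ≡ M′ k) →
               M i ≡ L i → M′ i ≢ L i → numDiff L M′ ≡ suc (numDiff L M)
numDiff-bump {suc r} L M M′ i agree Mi≡Li M′i≢Li = begin
  numDiff L M′                                      ≡⟨ numDiff≡∑ L M′ ⟩
  sum g′                                            ≡⟨ sum-remove g′ ⟩
  g′ i + sum (Vector.removeAt g′ i)                 ≡⟨ cong₂ _+_ g′i≡1 (sum-cong-≗ agree-off-i) ⟩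
  1 + sum (Vector.removeAt g i)                     ≡⟨ cong (λ e → suc (e + sum (Vector.removeAt g i))) gi≡0 ⟨
  suc (g i + sum (Vector.removeAt g i))             ≡⟨ cong suc (sum-remove g) ⟨
  suc (sum g)                                       ≡⟨ cong suc (numDiff≡∑ L M) ⟨
  suc (numDiff L M)                                 ∎
  where
  open ≡-Reasoning
  g g′ : Fin (suc r) → ℕ
  g  = mismatch L M
  g′ = mismatch L M′
  g′i≡1 : g′ i ≡ 1
  g′i≡1 = cong (λ b → if b then 0 else 1) (⌊⌋-no _ M′i≢Li)
  gi≡0 : g i ≡ 0
  gi≡0 = cong (λ b → if b then 0 else 1) (⌊⌋-yes _ Mi≡Li)
  agree-off-i : ∀ k → g′ (punchIn i k) ≡ g (punchIn i k)
  agree-off-i k = cong (λ m → if ⌊ m ≟ L (punchIn i k) ⌋ then 0 else 1)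
                       (sym (agree _ (punchInᵢ≢i i k)))

replaceAt-at : (L′ : Fin r → Fin n) (i : Fin r) (a : Fin n) → replaceAt L′ i a i ≡ a
replaceAt-at L′ i a = cong (λ b → if b then a else L′ i) (⌊⌋-yes (i ≟ i) refl)

replaceAt-off : (L′ : Fin r → Fin n) (i : Fin r) (a : Fin n) {k : Fin r} → k ≢ i →
                replaceAt L′ i a k ≡ L′ k
replaceAt-off L′ i a {k} k≢i = cong (λ b → if b then a else L′ k) (⌊⌋-no (k ≟ i) k≢i)

inRange-true : (L′ : Fin r → Fin n) (i : Fin r) (a : Fin n) → (∀ k → L′ k ≡ a → k ≡ i) →
               inRange L′ i a ≡ true
inRange-true L′ i a only-at-i with any? (λ k → L′ k ≟ a)
... | yes (k , L′k≡a) = ⌊⌋-yes (a ≟ L′ i) (trans (sym L′k≡a) (cong L′ (only-at-i k L′k≡a)))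
... | no _            = refl

inRange-false : (L′ : Fin r → Fin n) (i : Fin r) (a : Fin n) (k : Fin r) → L′ k ≡ a → a ≢ L′ i →
                inRange L′ i a ≡ false
inRange-false L′ i a k L′k≡a a≢L′i = cong₂ (λ b b′ → (if b then false else true) ∨ b′)
  (⌊⌋-yes (any? (λ k → L′ k ≟ a)) (k , L′k≡a)) (⌊⌋-no (a ≟ L′ i) a≢L′i)

module Replacement (L L′ : Fin r → Fin n) (i : Fin r) where

  term : Fin n → ℚ
  term a = if inRange L′ i a then c L (replaceAt L′ i a) else 0ℚ

  sumℚ≡∑ : sumℚ (allFin n) term ≡ ℚΣ.sum term
  sumℚ≡∑ = foldr-map-tabulate ℚ._+_ 0ℚ term (λ a → a)

  term-vanishes : ∀ a → c L (replaceAt L′ i a) ≡ 0ℚ → term a ≡ 0ℚ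
  term-vanishes a c≡0 with inRange L′ i a
  ... | true  = c≡0
  ... | false = refl

  PersistentCrossHit : Set
  PersistentCrossHit = ∃₂ λ k j → j ≢ i × k ≢ j × L′ j ≡ L k

  persistentCrossHit? : Dec PersistentCrossHit
  persistentCrossHit? = any? λ k → any? λ j → ¬? (j ≟ i) ×-dec ¬? (k ≟ j) ×-dec (L′ j ≟ L k)

  sum-vanishes-by-crossHit : PersistentCrossHit → sumℚ (allFin n) term ≡ 0ℚ
  sum-vanishes-by-crossHit (k , j , j≢i , k≢j , L′j≡Lk) = begin
    sumℚ (allFin n) term  ≡⟨ sumℚ≡∑ ⟩
    ℚΣ.sum term           ≡⟨ ℚΣ.sum-cong-≗ (λ a → term-vanishes a (c-crossHit L _ (hit a))) ⟩
    ℚΣ.sum {n} (λ _ → 0ℚ) ≡⟨ ℚΣ.sum-replicate-zero n ⟩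
    0ℚ                    ∎
    where
    open ≡-Reasoning
    hit : ∀ a → CrossHit L (replaceAt L′ i a)
    hit a = k , j , k≢j , trans (replaceAt-off L′ i a j≢i) L′j≡Lk

  module NoPersistentCrossHit (L-injective : Injective _≡_ _≡_ L) (L′-injective : Injective _≡_ _≡_ L′)
                              (¬hit : ¬ PersistentCrossHit) where

    -- N agrees with L at i, so z counts the k ≠ i with l′_k ≠ l_k.
    N : Fin r → Fin n
    N = replaceAt L′ i (L i)

    z : ℕ
    z = numDiff L N

    Mismatch? : (k : Fin r) → Dec (N k ≢ L k)
    Mismatch? k = ¬? (N k ≟ L k)

    -- As a set U is I_L ∪ (I_L′ ∖ {l′_i}); listing l′_k only when l′_k ≠ l_k keeps it duplicate-free.
    U : List (Fin n)
    U = map L (allFin r) ++ map L′ (filter Mismatch? (allFin r))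

    mismatch⇒≢i : ∀ {k} → N k ≢ L k → k ≢ i
    mismatch⇒≢i Nk≢Lk refl = Nk≢Lk (replaceAt-at L′ i (L i))

    ∈mismatched⁻ : ∀ {a} → a ∈ map L′ (filter Mismatch? (allFin r)) →
                   ∃ λ k → k ≢ i × L′ k ≢ L k × a ≡ L′ k
    ∈mismatched⁻ a∈ with ∈-map⁻ L′ a∈
    ... | k , k∈ , a≡L′k =
      k , k≢i , (λ L′k≡Lk → Nk≢Lk (trans (replaceAt-off L′ i (L i) k≢i) L′k≡Lk)) , a≡L′k
      where
      Nk≢Lk = proj₂ (∈-filter⁻ Mismatch? {xs = allFin r} k∈)
      k≢i = mismatch⇒≢i Nk≢Lk

    L∈U : ∀ k → L k ∈ U
    L∈U k = ∈-++⁺ˡ (∈-map⁺ L (∈-allFin k))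

    L′∈U : ∀ k → k ≢ i → L′ k ∈ U
    L′∈U k k≢i with L′ k ≟ L k
    ... | yes L′k≡Lk = subst (_∈ U) (sym L′k≡Lk) (L∈U k)
    ... | no  L′k≢Lk =
      ∈-++⁺ʳ (map L (allFin r)) (∈-map⁺ L′ (∈-filter⁺ Mismatch? (∈-allFin k) Nk≢Lk))
      where
      Nk≢Lk : N k ≢ L k
      Nk≢Lk Nk≡Lk = L′k≢Lk (trans (sym (replaceAt-off L′ i (L i) k≢i)) Nk≡Lk)

    ∈U⁻ : ∀ {a} → a ∈ U → (∃ λ k → a ≡ L k) ⊎ (∃ λ k → k ≢ i × a ≡ L′ k)
    ∈U⁻ a∈U with ∈-++⁻ (map L (allFin r)) a∈U
    ... | inj₁ a∈L with ∈-map⁻ L a∈L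
    ...   | k , _ , a≡Lk = inj₁ (k , a≡Lk)
    ∈U⁻ a∈U | inj₂ a∈L′ with ∈mismatched⁻ a∈L′
    ...   | k , k≢i , _ , a≡L′k = inj₂ (k , k≢i , a≡L′k)

    U-unique : Unique U
    U-unique = Unique.++⁺ (Unique.map⁺ L-injective (Unique.allFin⁺ r))
                          (Unique.map⁺ L′-injective (Unique.filter⁺ Mismatch? (Unique.allFin⁺ r)))
                          disjoint
      where
      disjoint : ∀ {a} → ¬ (a ∈ map L (allFin r) × a ∈ map L′ (filter Mismatch? (allFin r)))
      disjoint (a∈L , a∈L′) with ∈-map⁻ L a∈L | ∈mismatched⁻ a∈L′
      ... | l , _ , a≡Ll | k , k≢i , L′k≢Lk , a≡L′k with l ≟ k
      ...   | yes refl = L′k≢Lk (trans (sym a≡L′k) a≡Ll)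
      ...   | no  l≢k  = ¬hit (l , k , k≢i , l≢k , trans (sym a≡L′k) a≡Ll)

    length-U : length U ≡ r + z
    length-U = trans (List.length-++ (map L (allFin r)))
      (cong₂ _+_ (trans (List.length-map L (allFin r)) (List.length-tabulate (λ k → k)))
                 (trans (List.length-map L′ (filter Mismatch? (allFin r))) (sym (numDiff≡length L N))))

    noCrossHit : ∀ a → (∀ k → k ≢ i → a ≢ L k) → ¬ CrossHit L (replaceAt L′ i a)
    noCrossHit a a≢L[k≢i] (k , j , k≢j , L′[a]j≡Lk) with j ≟ i
    ... | yes refl = a≢L[k≢i] k k≢j L′[a]j≡Lk
    ... | no  j≢i  = ¬hit (k , j , j≢i , k≢j , L′[a]j≡Lk)

    x y : ℚ
    x = signedInverseFalling (n ∸ r) z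
    y = signedInverseFalling (n ∸ r) (suc z)

    term-at-Li : term (L i) ≡ x
    term-at-Li = trans (cong (λ b → if b then c L N else 0ℚ) (inRange-true L′ i (L i) only-at-i))
                       (c-noCrossHit L N (noCrossHit (L i) Li≢L[k≢i]))
      where
      Li≢L[k≢i] : ∀ k → k ≢ i → L i ≢ L k
      Li≢L[k≢i] k k≢i Li≡Lk = k≢i (sym (L-injective Li≡Lk))
      only-at-i : ∀ k → L′ k ≡ L i → k ≡ i
      only-at-i k L′k≡Li with k ≟ i
      ... | yes k≡i = k≡i
      ... | no  k≢i = contradiction (i , k , k≢i , (λ i≡k → k≢i (sym i≡k)) , L′k≡Li) ¬hit

    term-in-U : ∀ {a} → a ≢ L i → a ∈ U → term a ≡ 0ℚ
    term-in-U {a} a≢Li a∈U with ∈U⁻ a∈U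
    ... | inj₁ (k , refl) = term-vanishes a (c-crossHit L _ (k , i , k≢i , replaceAt-at L′ i a))
      where
      k≢i : k ≢ i
      k≢i refl = a≢Li refl
    ... | inj₂ (k , k≢i , refl) =
      cong (λ b → if b then c L (replaceAt L′ i a) else 0ℚ)
           (inRange-false L′ i a k refl (k≢i ∘ L′-injective))

    term-outside-U : ∀ {a} → a ∉ U → term a ≡ y
    term-outside-U {a} a∉U = begin
      term a
        ≡⟨ cong (λ b → if b then c L M else 0ℚ) (inRange-true L′ i a only-at-i) ⟩
      c L M
        ≡⟨ c-noCrossHit L M (noCrossHit a a≢L[k]) ⟩
      signedInverseFalling (n ∸ r) (numDiff L M)
        ≡⟨ cong (signedInverseFalling (n ∸ r)) (numDiff-bump L N M i agree (replaceAt-at L′ i (L i)) Mi≢Li) ⟩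
      y ∎
      where
      open ≡-Reasoning
      M = replaceAt L′ i a
      a≢L[k] : ∀ k → k ≢ i → a ≢ L k
      a≢L[k] k _ a≡Lk = a∉U (subst (_∈ U) (sym a≡Lk) (L∈U k))
      only-at-i : ∀ k → L′ k ≡ a → k ≡ i
      only-at-i k L′k≡a with k ≟ i
      ... | yes k≡i = k≡i
      ... | no  k≢i = contradiction (subst (_∈ U) L′k≡a (L′∈U k k≢i)) a∉U
      agree : ∀ k → k ≢ i → N k ≡ M k
      agree k k≢i = trans (replaceAt-off L′ i (L i) k≢i) (sym (replaceAt-off L′ i a k≢i))
      Mi≢Li : M i ≢ L i
      Mi≢Li Mi≡Li = a∉U (subst (_∈ U) (trans (sym Mi≡Li) (replaceAt-at L′ i a)) (L∈U i))

    term-decomposition : ∀ a → term a ≡ 𝟙 (a ≟ L i) ×ℚ x ℚ.+ 𝟙 (a ∉? U) ×ℚ y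
    term-decomposition a with a ≟ L i | a ∈? U
    ... | yes refl | yes _   = trans term-at-Li (sym (trans (ℚ.+-identityʳ _) (ℚ.+-identityʳ x)))
    ... | yes refl | no Li∉U = contradiction (L∈U i) Li∉U
    ... | no a≢Li  | yes a∈U = trans (term-in-U a≢Li a∈U) (sym (ℚ.+-identityʳ 0ℚ))
    ... | no _     | no a∉U  =
      trans (term-outside-U a∉U) (sym (trans (ℚ.+-identityˡ _) (ℚ.+-identityʳ y)))

    count-outside-U : ∑[ a < n ] 𝟙 (a ∉? U) ≡ n ∸ r ∸ z
    count-outside-U = begin
      S                          ≡⟨ ℕ.m+n∸n≡m S (r + z) ⟨
      S + (r + z) ∸ (r + z)      ≡⟨ cong (λ l → S + l ∸ (r + z)) length-U ⟨
      S + length U ∸ (r + z)     ≡⟨ cong (_∸ (r + z)) (∑-𝟙∉ U U-unique) ⟩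
      n ∸ (r + z)                ≡⟨ ℕ.∸-+-assoc n r z ⟨
      n ∸ r ∸ z                  ∎
      where
      open ≡-Reasoning
      S = ∑[ a < n ] 𝟙 (a ∉? U)

    z<n∸r : 2 * r ≤ n → z < n ∸ r
    z<n∸r 2r≤n = ℕ.<-≤-trans (numDiff-< L N i (replaceAt-at L′ i (L i)))
                             (ℕ.m+n≤o⇒m≤o∸n r (subst (_≤ n) (cong (r +_) (ℕ.+-identityʳ r)) 2r≤n))

    sum-vanishes : 2 * r ≤ n → sumℚ (allFin n) term ≡ 0ℚ
    sum-vanishes 2r≤n = begin
      sumℚ (allFin n) term
        ≡⟨ sumℚ≡∑ ⟩
      ℚΣ.sum term
        ≡⟨ ℚΣ.sum-cong-≗ term-decomposition ⟩
      ℚΣ.sum (λ a → at-Li a ×ℚ x ℚ.+ outside-U a ×ℚ y)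
        ≡⟨ ℚΣ.∑-distrib-+ (λ a → at-Li a ×ℚ x) (λ a → outside-U a ×ℚ y) ⟩
      ℚΣ.sum (λ a → at-Li a ×ℚ x) ℚ.+ ℚΣ.sum (λ a → outside-U a ×ℚ y)
        ≡⟨ cong₂ ℚ._+_ (∑-× ℚ.+-0-monoid at-Li x) (∑-× ℚ.+-0-monoid outside-U y) ⟩
      sum at-Li ×ℚ x ℚ.+ sum outside-U ×ℚ y
        ≡⟨ cong₂ (λ p q → p ×ℚ x ℚ.+ q ×ℚ y) (∑-𝟙≟ (L i)) count-outside-U ⟩
      1 ×ℚ x ℚ.+ (n ∸ r ∸ z) ×ℚ y
        ≡⟨ cong (ℚ._+ (n ∸ r ∸ z) ×ℚ y) (ℚ.+-identityʳ x) ⟩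
      x ℚ.+ (n ∸ r ∸ z) ×ℚ y
        ≡⟨ signedInverseFalling-recurrence (z<n∸r 2r≤n) ⟩
      0ℚ ∎
      where
      open ≡-Reasoning
      at-Li outside-U : Fin n → ℕ
      at-Li a = 𝟙 (a ≟ L i)
      outside-U a = 𝟙 (a ∉? U)

mainTheorem10 : (n r : ℕ) → 2 * r ≤ n → (L L' : Fin r → Fin n) →
    Injective _≡_ _≡_ L → Injective _≡_ _≡_ L' → (i : Fin r) →
    sumℚ (allFin n) (λ a → if inRange L' i a then c L (replaceAt L' i a) else 0ℚ) ≡ 0ℚ
mainTheorem10 n r 2r≤n L L′ L-injective L′-injective i with Replacement.persistentCrossHit? L L′ i
... | yes hit = Replacement.sum-vanishes-by-crossHit L L′ i hit
... | no ¬hit = Replacement.NoPersistentCrossHit.sum-vanishes L L′ i L-injective L′-injective ¬hit 2r≤n
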